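{- Let $\ell\ge2$, $r\ge2$, $m\in\mathbb{Z}_{\ge0}$, $k\in\mathbb{Z}$ with $k\geq -m-1$, and integers $\overline{m}_1,\dots,\overline{m}_\ell$ with $0\le\overline{m}_i\le r-1$ such that $m_i:=r(m+k)+1+\overline{m}_i\ge0$ for all $i$. Let $\lambda(t)=\prod_{i=1}^\ell(t^r-x_i^r)$ and for $u\in\mathbb{Z}$ let \[ \eta^m_u=\sum_{i=1}^\ell\left(\int^{x_i}t^{ru}\lambda(t)^m\,dt\right)\partial_i . \] (1) If $u\ge -m$, then $\eta_u^m$ is a polynomial vector field (all its coefficients lie in $\mathbb{C}[x_1,\dots,x_\ell]$). (2) The vector field $\left(\prod_{i=1}^\ell x_i^{\overline{m}_i}\right)\eta^m_k$ is a polynomial vector field.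
   Context: $\partial_i=\partial/\partial x_i$. The operator $\int^{x_i}\,dt$ is the linear operator on Laurent polynomials in $t$ with coefficients in $\mathbb{C}[x_1,\dots,x_\ell]$ defined by $\int^{x_i}t^j\,dt=\frac{x_i^{j+1}}{j+1}$ for $j\neq-1$ (extended linearly over the coefficients); since all exponents of $t$ in $t^{ru}\lambda(t)^m$ are multiples of $r\geq 2$, this is well defined. For $j\ge0$ it agrees with $\int_0^{x_i}$, and for $j<-1$ with $\int_\infty^{x_i}$. A priori the coefficients of $\eta_u^m$ are Laurent polynomials in the $x_i$. -}

module Defs where

open import Data.Nat as ℕ using (ℕ; zero; suc)
open import Data.Integer as ℤ using (ℤ; +_; -[1+_]; 0ℤ; 1ℤ)
open import Data.Rational as ℚ using (ℚ; 0ℚ; 1ℚ)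
open import Data.Fin using (Fin)
open import Data.Vec as Vec using (Vec; replicate; zipWith; updateAt)
open import Data.Vec.Properties using (≡-dec)
open import Data.Vec.Relation.Unary.All using (All)
open import Data.List as List using (List; []; _∷_; _++_; concatMap; foldr)
open import Data.Product using (_×_; _,_)
open import Relation.Binary.PropositionalEquality using (_≡_)
open import Relation.Nullary using (¬_; yes; no)

-- A (multivariate) Laurent polynomial with rational coefficients in the
-- variables x_1..x_ℓ, represented as a finite formal sum of terms
-- c · x^e  (c : ℚ, e : Vec ℤ ℓ an exponent vector).
LPoly : ℕ → Set
LPoly ℓ = List (ℚ × Vec ℤ ℓ)

-- Laurent polynomials in t, x_1..x_ℓ : terms c · t^j · x^e.
TPoly : ℕ → Set
TPoly ℓ = List (ℚ × ℤ × Vec ℤ ℓ)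

coeff : ∀ {ℓ} → LPoly ℓ → Vec ℤ ℓ → ℚ
coeff [] e = 0ℚ
coeff ((c , e′) ∷ p) e with ≡-dec ℤ._≟_ e′ e
... | yes _ = c ℚ.+ coeff p e
... | no  _ = coeff p e

IsPolynomial : ∀ {ℓ} → LPoly ℓ → Set
IsPolynomial {ℓ} p = (e : Vec ℤ ℓ) → ¬ (coeff p e ≡ 0ℚ) → All (0ℤ ℤ.≤_) e

-- a vector field Σ_i f_i ∂_i, given by its coefficient functions
VField : ℕ → Set
VField ℓ = Fin ℓ → LPoly ℓ

IsPolynomialVF : ∀ {ℓ} → VField ℓ → Set
IsPolynomialVF v = ∀ i → IsPolynomial (v i)

zeroV : ∀ {ℓ} → Vec ℤ ℓ
zeroV {ℓ} = replicate ℓ 0ℤ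

addV : ∀ {ℓ} → Vec ℤ ℓ → Vec ℤ ℓ → Vec ℤ ℓ
addV = zipWith ℤ._+_

tmul : ∀ {ℓ} → TPoly ℓ → TPoly ℓ → TPoly ℓ
tmul p q = concatMap (λ { (c , j , e) → List.map (λ { (d , k , f) → (c ℚ.* d , j ℤ.+ k , addV e f) }) q }) p

tone : ∀ {ℓ} → TPoly ℓ
tone = (1ℚ , 0ℤ , zeroV) ∷ []

tpow : ∀ {ℓ} → TPoly ℓ → ℕ → TPoly ℓ
tpow p zero = tone
tpow p (suc n) = tmul p (tpow p n)

tprod : ∀ {ℓ} → List (TPoly ℓ) → TPoly ℓ
tprod = foldr tmul tone

tvar^ : ∀ {ℓ} → ℤ → TPoly ℓ
tvar^ a = (1ℚ , a , zeroV) ∷ []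

-- λ(t) = ∏_{j=1}^ℓ (t^r - x_j^r)
lam : (ℓ r : ℕ) → TPoly ℓ
lam ℓ r = tprod (List.map (λ j → (1ℚ , + r , zeroV) ∷ (ℚ.- 1ℚ , 0ℤ , updateAt zeroV j (λ _ → + r)) ∷ [])
                          (List.allFin ℓ))

-- 1/n for a nonzero integer n (the value at 0 is irrelevant: never used)
invℤ : ℤ → ℚ
invℤ (+ zero) = 0ℚ
invℤ (+ suc k) = 1ℤ ℚ./ suc k
invℤ -[1+ k ] = ℤ.- 1ℤ ℚ./ suc k

-- ∫^{x_i} · dt : t^j ↦ x_i^{j+1}/(j+1)  (j ≠ -1), extended linearly
integ : ∀ {ℓ} → Fin ℓ → TPoly ℓ → LPoly ℓ
integ i = List.map (λ { (c , j , e) → (c ℚ.* invℤ (j ℤ.+ 1ℤ) , updateAt e i (ℤ._+ (j ℤ.+ 1ℤ))) })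

eta : (ℓ r m : ℕ) → ℤ → VField ℓ
eta ℓ r m u i = integ i (tmul (tvar^ (+ r ℤ.* u)) (tpow (lam ℓ r) m))

monoMul : ∀ {ℓ} → Vec ℤ ℓ → LPoly ℓ → LPoly ℓ
monoMul e = List.map (λ { (c , f) → (c , addV e f) })

-- Every term c·tʲ·xᵉ of the integrand t^{ru} λ(t)^m has nonnegative x_i-exponent and
-- total degree at least r(u + m) in (t, x_i): this holds for t^{ru}, for each factor
-- t^r − x_j^r (with degree ≥ r when j = i) and is additive under products.
-- Integrating in x_i turns c·tʲ·xᵉ into a multiple of x^e·x_i^{j+1}, whose x_i-exponent
-- e_i + j + 1 is therefore at least r(u + m) + 1, while the other exponents are unchanged.
-- For u ≥ −m this exponent is positive; for u = k it is at least r(m + k) + 1, which the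
-- factor x_i^{m̄_i} makes nonnegative. Coefficients never enter the argument, so neither
-- does the junk value 1/0 = 0 that integ uses at j = −1.
{-# OPTIONS --safe #-}
module Submission where

open import Defs
open import Data.Nat as ℕ using (ℕ; _≤_; _<_; zero; suc)
open import Data.Integer as ℤ using (ℤ; +_; 0ℤ; 1ℤ; _+_; _*_; -_; +≤+)
open import Data.Integer.Properties
  using (≤-refl; ≤-reflexive; ≤-trans; i≤i+j; +-mono-≤; +-monoˡ-≤; +-monoʳ-≤; +-identityʳ; +-identityˡ; +-assoc; +-inverseˡ;
         *-zeroʳ; *-distribˡ-+; *-monoˡ-≤-nonNeg)
open import Data.Integer.Tactic.RingSolver using (solve-∀)
open import Data.Rational as ℚ using (ℚ; 1ℚ)
open import Data.Fin using (Fin)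
open import Data.Fin.Properties using () renaming (_≟_ to _≟ᶠ_)
open import Data.Vec using (Vec; map; lookup; updateAt)
open import Data.Vec.Properties using (≡-dec; lookup∘updateAt; lookup∘updateAt′; lookup-zipWith; lookup-replicate; lookup-map; zipWith-identityˡ)
open import Data.Vec.Relation.Unary.All as Vecᴬ using ()
open import Data.Vec.Relation.Unary.All.Properties using (lookup⁻)
open import Data.List as List using (List; []; _∷_)
open import Data.List.Relation.Unary.All as All using (All; []; _∷_)
open import Data.List.Relation.Unary.All.Properties using (++⁺; map⁺)
open import Data.List.Relation.Unary.Any using (here; there)
open import Data.List.Membership.Propositional using (_∈_)
open import Data.List.Membership.Propositional.Properties using (∈-allFin)
open import Data.Product using (_×_; _,_; proj₁; proj₂)
open import Data.Empty using (⊥-elim)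
open import Relation.Binary.PropositionalEquality using (_≡_; refl; sym; trans; cong; subst; subst₂)
open import Relation.Nullary using (yes; no)

private
  variable
    ℓ : ℕ

Term : ℕ → Set
Term ℓ = ℚ × ℤ × Vec ℤ ℓ

_·ₜ_ : Term ℓ → Term ℓ → Term ℓ
(c , j , e) ·ₜ (d , k , f) = (c ℚ.* d , j + k , addV e f)

All-tmul : ∀ {P Q R : Term ℓ → Set} → (∀ {t s} → P t → Q s → R (t ·ₜ s)) →
           ∀ {p q} → All P p → All Q q → All R (tmul p q)
All-tmul mul []         Qq = []
All-tmul mul (Pt ∷ Pp) Qq = ++⁺ (map⁺ (All.map (mul Pt) Qq)) (All-tmul mul Pp Qq)

isPolynomial-fromAll : {p : LPoly ℓ} → All (λ { (c , e) → Vecᴬ.All (0ℤ ℤ.≤_) e }) p → IsPolynomial p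
isPolynomial-fromAll []       e c≢0 = ⊥-elim (c≢0 refl)
isPolynomial-fromAll {p = (c , e′) ∷ p} (e′≥0 ∷ p≥0) e c≢0 with ≡-dec ℤ._≟_ e′ e
... | yes refl = e′≥0
... | no  _    = isPolynomial-fromAll p≥0 e c≢0

Order≥ : Fin ℓ → ℤ → Term ℓ → Set
Order≥ i n (c , j , e) = 0ℤ ℤ.≤ lookup e i × n ℤ.≤ lookup e i + j

Order≥-·ₜ : ∀ (i : Fin ℓ) {a b} {t s : Term ℓ} → Order≥ i a t → Order≥ i b s → Order≥ i (a + b) (t ·ₜ s)
Order≥-·ₜ i {a} {b} {c , j , e} {d , k , f} (eᵢ≥0 , a≤eᵢ+j) (fᵢ≥0 , b≤fᵢ+k)
  rewrite lookup-zipWith _+_ i e f =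
  +-mono-≤ eᵢ≥0 fᵢ≥0 , subst (a + b ℤ.≤_) (interchange (lookup e i) (lookup f i) j k) (+-mono-≤ a≤eᵢ+j b≤fᵢ+k)
  where
  interchange : ∀ x y j k → (x + j) + (y + k) ≡ (x + y) + (j + k)
  interchange = solve-∀

Order≥-tmul : ∀ (i : Fin ℓ) {a b} {p q : TPoly ℓ} →
              All (Order≥ i a) p → All (Order≥ i b) q → All (Order≥ i (a + b)) (tmul p q)
Order≥-tmul i = All-tmul λ {t} {s} → Order≥-·ₜ i {t = t} {s = s}

Order≥-tvar^ : ∀ (i : Fin ℓ) a → All (Order≥ i a) (tvar^ a)
Order≥-tvar^ {ℓ} i a = (≤-reflexive (sym 0ᵢ) , ≤-reflexive (sym (trans (cong (_+ a) 0ᵢ) (+-identityˡ a)))) ∷ []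
  where
  0ᵢ : lookup (zeroV {ℓ}) i ≡ 0ℤ
  0ᵢ = lookup-replicate i 0ℤ

-- Must agree definitionally with the factors t^r − x_j^r in lam.
factor : ℕ → Fin ℓ → TPoly ℓ
factor r j = (1ℚ , + r , zeroV) ∷ (ℚ.- 1ℚ , 0ℤ , updateAt zeroV j (λ _ → + r)) ∷ []

Order≥-factor : ∀ r (i j : Fin ℓ) → All (Order≥ i 0ℤ) (factor r j)
Order≥-factor r i j = t^r-term ∷ (0≤eᵢ , 0≤eᵢ+0) ∷ []
  where
  t^r-term : Order≥ i 0ℤ (1ℚ , + r , zeroV)
  t^r-term with All.head (Order≥-tvar^ i (+ r))
  ... | 0≤0 , r≤0+r = 0≤0 , ≤-trans (+≤+ ℕ.z≤n) r≤0+r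
  eᵢ : ℤ
  eᵢ = lookup (updateAt zeroV j (λ _ → + r)) i
  0≤eᵢ : 0ℤ ℤ.≤ eᵢ
  0≤eᵢ with i ≟ᶠ j
  ... | yes refl rewrite lookup∘updateAt i {λ _ → + r} zeroV = +≤+ ℕ.z≤n
  ... | no  i≢j  rewrite lookup∘updateAt′ i j {λ _ → + r} i≢j zeroV | lookup-replicate i 0ℤ = ≤-refl
  0≤eᵢ+0 : 0ℤ ℤ.≤ eᵢ + 0ℤ
  0≤eᵢ+0 = subst (0ℤ ℤ.≤_) (sym (+-identityʳ eᵢ)) 0≤eᵢ

Order≥-factor-diagonal : ∀ r (i : Fin ℓ) → All (Order≥ i (+ r)) (factor r i)
Order≥-factor-diagonal r i = All.head (Order≥-tvar^ i (+ r)) ∷ (0≤r , r≤r+0) ∷ []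
  where
  rᵢ : lookup (updateAt zeroV i (λ _ → + r)) i ≡ + r
  rᵢ = lookup∘updateAt i zeroV
  0≤r : 0ℤ ℤ.≤ lookup (updateAt zeroV i (λ _ → + r)) i
  0≤r = subst (0ℤ ℤ.≤_) (sym rᵢ) (+≤+ ℕ.z≤n)
  r≤r+0 : + r ℤ.≤ lookup (updateAt zeroV i (λ _ → + r)) i + 0ℤ
  r≤r+0 = ≤-reflexive (sym (trans (+-identityʳ _) rᵢ))

Order≥-prod-factors : ∀ r (i : Fin ℓ) (js : List (Fin ℓ)) → i ∈ js →
                      All (Order≥ i (+ r)) (tprod (List.map (factor r) js))
Order≥-prod-factors r i (j ∷ js) (here refl) =
  subst (λ n → All (Order≥ i n) (tprod (List.map (factor r) (i ∷ js)))) (+-identityʳ (+ r))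
        (Order≥-tmul i (Order≥-factor-diagonal r i) (x-free js))
  where
  x-free : ∀ js → All (Order≥ i 0ℤ) (tprod (List.map (factor r) js))
  x-free []       = Order≥-tvar^ i 0ℤ
  x-free (j ∷ js) = Order≥-tmul i (Order≥-factor r i j) (x-free js)
Order≥-prod-factors r i (j ∷ js) (there i∈js) =
  Order≥-tmul i (Order≥-factor r i j) (Order≥-prod-factors r i js i∈js)

Order≥-lam : ∀ ℓ r (i : Fin ℓ) → All (Order≥ i (+ r)) (lam ℓ r)
Order≥-lam ℓ r i = Order≥-prod-factors r i (List.allFin ℓ) (∈-allFin i)

Order≥-tpow : ∀ (i : Fin ℓ) {a} {p : TPoly ℓ} m → All (Order≥ i a) p → All (Order≥ i (a * + m)) (tpow p m)
Order≥-tpow i {a} zero    _  = subst (λ n → All (Order≥ i n) _) (sym (*-zeroʳ a)) (Order≥-tvar^ i 0ℤ)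
Order≥-tpow i {a} (suc m) pa = subst (λ n → All (Order≥ i n) _) (a+a*m≡a*[1+m] a (+ m))
                                     (Order≥-tmul i pa (Order≥-tpow i m pa))
  where
  a+a*m≡a*[1+m] : ∀ a m → a + a * m ≡ a * (1ℤ + m)
  a+a*m≡a*[1+m] = solve-∀

Order≥-integrand : ∀ ℓ r m u (i : Fin ℓ) →
                   All (Order≥ i (+ r * u + + r * + m)) (tmul (tvar^ (+ r * u)) (tpow (lam ℓ r) m))
Order≥-integrand ℓ r m u i = Order≥-tmul i (Order≥-tvar^ i (+ r * u)) (Order≥-tpow i m (Order≥-lam ℓ r i))

integExponent : Fin ℓ → Term ℓ → Vec ℤ ℓ
integExponent i (c , j , e) = updateAt e i (_+ (j + 1ℤ))

shifted-integExponent-nonneg : ∀ (i′ : Fin ℓ) {n} (s : Vec ℤ ℓ) →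
  (∀ i → 0ℤ ℤ.≤ lookup s i) → (∀ i → 0ℤ ℤ.≤ lookup s i + (n + 1ℤ)) →
  (t : Term ℓ) → (∀ i → Order≥ i n t) → Vecᴬ.All (0ℤ ℤ.≤_) (addV s (integExponent i′ t))
shifted-integExponent-nonneg i′ {n} s s≥0 s+n+1≥0 (c , j , e) t≥n = lookup⁻ nonneg
  where
  nonneg : ∀ i → 0ℤ ℤ.≤ lookup (addV s (updateAt e i′ (_+ (j + 1ℤ)))) i
  nonneg i rewrite lookup-zipWith _+_ i s (updateAt e i′ (_+ (j + 1ℤ))) with i ≟ᶠ i′
  ... | yes refl rewrite lookup∘updateAt i {_+ (j + 1ℤ)} e =
    ≤-trans (s+n+1≥0 i) (+-monoʳ-≤ (lookup s i)
      (subst (n + 1ℤ ℤ.≤_) (+-assoc (lookup e i) j 1ℤ) (+-monoˡ-≤ 1ℤ (proj₂ (t≥n i)))))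
  ... | no  i≢i′ rewrite lookup∘updateAt′ i i′ {_+ (j + 1ℤ)} i≢i′ e =
    +-mono-≤ (s≥0 i) (proj₁ (t≥n i))

monoMul-integ-isPolynomial : ∀ (i′ : Fin ℓ) {n} (s : Vec ℤ ℓ) {p : TPoly ℓ} →
  (∀ i → 0ℤ ℤ.≤ lookup s i) → (∀ i → 0ℤ ℤ.≤ lookup s i + (n + 1ℤ)) →
  (∀ i → All (Order≥ i n) p) → IsPolynomial (monoMul s (integ i′ p))
monoMul-integ-isPolynomial i′ s s≥0 s+n+1≥0 p≥n =
  isPolynomial-fromAll (map⁺ (map⁺ (All.tabulate λ {t} t∈p →
    shifted-integExponent-nonneg i′ s s≥0 s+n+1≥0 t (λ i → All.lookup (p≥n i) t∈p))))

integ-isPolynomial : ∀ (i′ : Fin ℓ) {n} {p : TPoly ℓ} →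
  0ℤ ℤ.≤ n → (∀ i → All (Order≥ i n) p) → IsPolynomial (integ i′ p)
integ-isPolynomial {ℓ} i′ {n} n≥0 p≥n =
  isPolynomial-fromAll (map⁺ (All.tabulate λ {t} t∈p →
    subst (Vecᴬ.All (0ℤ ℤ.≤_)) (zipWith-identityˡ +-identityˡ (integExponent i′ t))
      (shifted-integExponent-nonneg i′ zeroV 0≤0ᵢ 0≤0ᵢ+n+1 t (λ i → All.lookup (p≥n i) t∈p))))
  where
  0ᵢ : ∀ i → lookup (zeroV {ℓ}) i ≡ 0ℤ
  0ᵢ i = lookup-replicate i 0ℤ
  0≤0ᵢ : ∀ i → 0ℤ ℤ.≤ lookup (zeroV {ℓ}) i
  0≤0ᵢ i = ≤-reflexive (sym (0ᵢ i))
  0≤0ᵢ+n+1 : ∀ i → 0ℤ ℤ.≤ lookup (zeroV {ℓ}) i + (n + 1ℤ)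
  0≤0ᵢ+n+1 i rewrite 0ᵢ i | +-identityˡ (n + 1ℤ) = ≤-trans n≥0 (i≤i+j n 1ℤ)

proposition3p3 : (ℓ r m : ℕ) (k : ℤ) (mbar : Vec ℕ ℓ) →
    2 ≤ ℓ → 2 ≤ r →
    ℤ.- (+ m) ℤ.- ℤ.1ℤ ℤ.≤ k →
    (∀ i → lookup mbar i < r) →
    (∀ i → ℤ.0ℤ ℤ.≤ + r ℤ.* (+ m ℤ.+ k) ℤ.+ ℤ.1ℤ ℤ.+ + lookup mbar i) →
    ((u : ℤ) → ℤ.- (+ m) ℤ.≤ u → IsPolynomialVF (eta ℓ r m u))
    × IsPolynomialVF (λ i → monoMul (map +_ mbar) (eta ℓ r m k i))
proposition3p3 ℓ r m k mbar _ _ _ _ m₁…mₗ≥0 = polynomial-for-u≥-m , polynomial-for-k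
  where
  polynomial-for-u≥-m : (u : ℤ) → - (+ m) ℤ.≤ u → IsPolynomialVF (eta ℓ r m u)
  polynomial-for-u≥-m u u≥-m i′ = integ-isPolynomial i′ order≥0 (Order≥-integrand ℓ r m u)
    where
    order≥0 : 0ℤ ℤ.≤ + r * u + + r * + m
    order≥0 = subst₂ ℤ._≤_ (*-zeroʳ (+ r)) (*-distribˡ-+ (+ r) u (+ m))
      (*-monoˡ-≤-nonNeg (+ r) (subst (ℤ._≤ u + + m) (+-inverseˡ (+ m)) (+-monoˡ-≤ (+ m) u≥-m)))
  polynomial-for-k : IsPolynomialVF (λ i → monoMul (map +_ mbar) (eta ℓ r m k i))
  polynomial-for-k i′ = monoMul-integ-isPolynomial i′ (map +_ mbar) mbarᵢ≥0 mᵢ≥0 (Order≥-integrand ℓ r m k)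
    where
    mbarᵢ≥0 : ∀ i → 0ℤ ℤ.≤ lookup (map +_ mbar) i
    mbarᵢ≥0 i rewrite lookup-map i +_ mbar = +≤+ ℕ.z≤n
    mᵢ≡ : ∀ r m k mb → r * (m + k) + 1ℤ + mb ≡ mb + ((r * k + r * m) + 1ℤ)
    mᵢ≡ = solve-∀
    mᵢ≥0 : ∀ i → 0ℤ ℤ.≤ lookup (map +_ mbar) i + ((+ r * k + + r * + m) + 1ℤ)
    mᵢ≥0 i rewrite lookup-map i +_ mbar = subst (0ℤ ℤ.≤_) (mᵢ≡ (+ r) (+ m) k (+ lookup mbar i)) (m₁…mₗ≥0 i)
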